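{- Let $d=(d_1,\ldots,d_n)$ be a sequence of positive integers, $\gamma\in[1,n]$, and let $G_{d,\gamma}$ be the flow network described in the context. Then $\min\{c(S,T) : (S,T)\in\mathscr S_{01}\}=\min\{c(S,T) : (S,T)\in\mathscr S_{10}\}$, where $\mathscr S_{01}$ is the set of $s$-$t$ cuts $(S,T)$ with $S\cap X_D=\emptyset$ and $T\cap Y_D\ne\emptyset$, and $\mathscr S_{10}$ is the set of $s$-$t$ cuts with $S\cap X_D\ne\emptyset$ and $T\cap Y_D=\emptyset$.
   Context: The network $G_{d,\gamma}$ has node set $\{s,t\}\cup X\cup Y\cup X'_S\cup Y'_S$, where $X=\{x_1,\ldots,x_n\}$, $Y=\{y_1,\ldots,y_n\}$, $X_D=\{x_i:i\in[1,\gamma]\}$, $Y_D=\{y_j:j\in[1,\gamma]\}$, $X_S=\{x_i:i\in[\gamma+1,n]\}$, $Y_S=\{y_j:j\in[\gamma+1,n]\}$, $X'_S=\{x'_i:i\in[\gamma+1,n]\}$, $Y'_S=\{y'_j:j\in[\gamma+1,n]\}$. Its directed edges with capacities are: $(s,x_i)$ cap. $d_i$ and $(y_i,t)$ cap. $d_i$ for $i\in[1,n]$; $(x_i,y_j)$ cap. 1 for $i,j\in[1,\gamma]$, $i\ne j$; $(x_i,y_j)$ cap. 1 for $i\in[1,\gamma]$, $j\in[\gamma+1,n]$; $(x_i,y_j)$ cap. 1 for $i\in[\gamma+1,n]$, $j\in[1,\gamma]$; $(x_i,x'_i)$ cap. $d_i-1$ and $(y'_i,y_i)$ cap. $d_i-1$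 for $i\in[\gamma+1,n]$; $(x'_i,y'_j)$ cap. 1 for $i,j\in[\gamma+1,n]$, $i\ne j$. An $s$-$t$ cut is a partition $(S,T)$ of the node set with $s\in S$, $t\in T$; its capacity $c(S,T)$ is the total capacity of edges directed from $S$ to $T$. $[a,b]=\{a,\ldots,b\}$. -}

module Defs where

open import Data.Nat using (ℕ; zero; suc; _+_; _*_; _∸_; _<_; _<?_)
open import Data.Fin using (Fin; toℕ; _≟_)
import Data.Fin as F
open import Data.Bool using (Bool; true; false; if_then_else_; not; _∧_)
open import Data.Product using (Σ; _×_; ∃)
open import Relation.Nullary.Decidable using (⌊_⌋)
open import Relation.Binary.PropositionalEquality using (_≡_)

∑ : ∀ {n} → (Fin n → ℕ) → ℕ
∑ {zero}  f = 0
∑ {suc n} f = f F.zero + ∑ (λ i → f (F.suc i))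

[_] : Bool → ℕ
[ b ] = if b then 1 else 0

-- Indices are 0-based: paper index i ∈ [1,n] is Fin element with toℕ = i-1.
-- i is a "D" index (paper i ∈ [1,γ]) iff toℕ i < γ; otherwise an "S" index.
isD : ∀ {n} → ℕ → Fin n → Bool
isD γ i = ⌊ toℕ i <? γ ⌋

-- An s-t cut (S,T): s ∈ S, t ∈ T fixed; for each remaining node we record
-- whether it lies in S (true) or T (false).  Primed nodes x'_i, y'_i exist
-- only for S-indices; the fields inX' / inY' are only ever read at S-indices
-- (their values at D-indices do not affect anything).
record Cut (n : ℕ) : Set where
  field
    inX  : Fin n → Bool
    inY  : Fin n → Bool
    inX' : Fin n → Bool
    inY' : Fin n → Bool
open Cut public

st : Bool → Bool → ℕ
st u v = [ u ∧ not v ]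

cap : ∀ {n} → (d : Fin n → ℕ) → (γ : ℕ) → Cut n → ℕ
cap {n} d γ C =
    ∑ (λ i → st true (inX C i) * d i)                        -- (s , x_i)
  + ∑ (λ i → st (inY C i) false * d i)                        -- (y_i , t)
  + ∑ (λ i → ∑ (λ j →                                         -- (x_i , y_j)
        [ edgeXY i j ] * st (inX C i) (inY C j)))
  + ∑ (λ i → [ not (isD γ i) ] *
        ( st (inX C i) (inX' C i) * (d i ∸ 1)                 -- (x_i , x'_i)
        + st (inY' C i) (inY C i) * (d i ∸ 1)))               -- (y'_i , y_i)
  + ∑ (λ i → ∑ (λ j →                                         -- (x'_i , y'_j)
        [ not (isD γ i) ∧ not (isD γ j) ∧ not ⌊ i ≟ j ⌋ ]
          * st (inX' C i) (inY' C j)))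
  where
  edgeXY : Fin n → Fin n → Bool
  edgeXY i j =
    if isD γ i
    then (if isD γ j then not ⌊ i ≟ j ⌋ else true)
    else isD γ j

In𝒮₀₁ : ∀ {n} → ℕ → Cut n → Set
In𝒮₀₁ γ C = (∀ i → isD γ i ≡ true → inX C i ≡ false)
          × ∃ (λ j → isD γ j ≡ true × inY C j ≡ false)

In𝒮₁₀ : ∀ {n} → ℕ → Cut n → Set
In𝒮₁₀ γ C = ∃ (λ i → isD γ i ≡ true × inX C i ≡ true)
          × (∀ j → isD γ j ≡ true → inY C j ≡ true)

IsMinCap : ∀ {n} → (Fin n → ℕ) → ℕ → (Cut n → Set) → ℕ → Set
IsMinCap d γ P m =
  Σ (Cut _) (λ C → P C × cap d γ C ≡ m)
  × (∀ C → P C → m Data.Nat.≤ cap d γ C)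

{-# OPTIONS --safe #-}
-- The map φ : s ↔ t, x_i ↔ y_i, x'_i ↔ y'_i is an isomorphism from G_{d,γ}
-- onto its reverse, because the edge sets {(x_i , y_j)} and {(x'_i , y'_j)} are
-- symmetric in i and j. So (S , T) ↦ (φ T , φ S) preserves capacities, and it
-- exchanges 𝒮₀₁ and 𝒮₁₀. The minimum over 𝒮₀₁ exists because there are finitely
-- many cuts and the cut S = {s} lies in 𝒮₀₁ (its T contains y_1).
module Submission where

open import Defs
open import Data.Nat using (ℕ; zero; suc; _+_; _*_; _∸_; _≤_)
open import Data.Nat.Properties using (+-comm; ≤-trans; ≤-reflexive; +-0-commutativeMonoid)
open import Data.Fin using (Fin; _≟_)
import Data.Fin as F
open import Data.Fin.Properties using (all?; any?)
open import Data.Bool using (Bool; true; false; not; _∧_; if_then_else_)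
import Data.Bool.Properties as Bool
open import Data.Vec using (Vec; []; _∷_; lookup; tabulate)
open import Data.Vec.Properties using (lookup∘tabulate)
open import Data.List using (List; filter; cartesianProduct; cartesianProductWith)
  renaming ([] to []ₗ; _∷_ to _∷ₗ_)
open import Data.List.Membership.Propositional using (_∈_)
open import Data.List.Membership.Propositional.Properties
  using (∈-filter⁺; ∈-cartesianProduct⁺; ∈-cartesianProductWith⁺)
open import Data.List.Relation.Unary.Any using (here; there)
import Data.List.Relation.Unary.All as All
open import Data.List.Relation.Unary.All.Properties using (all-filter)
open import Data.List.Extrema.Nat using (argmin; argmin-all; f[argmin]≤f[xs])
open import Data.Product using (Σ; ∃; ∃-syntax; _×_; _,_)
open import Function using (_∘_; mk⇔)
open import Relation.Nullary.Decidable using (⌊_⌋; _×-dec_; _→-dec_; isYes≗does; does-⇔)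
open import Relation.Unary using (Decidable)
open import Relation.Binary.PropositionalEquality
  using (_≡_; _≗_; refl; sym; trans; cong; cong₂; module ≡-Reasoning)
open import Algebra.Properties.CommutativeMonoid.Sum +-0-commutativeMonoid
  using (sum; sum-cong-≗) renaming (∑-comm to sum-comm)

∑≡sum : ∀ {n} (f : Fin n → ℕ) → ∑ f ≡ sum f
∑≡sum {zero}  f = refl
∑≡sum {suc n} f = cong (f F.zero +_) (∑≡sum (f ∘ F.suc))

∑-cong : ∀ {n} {f g : Fin n → ℕ} → f ≗ g → ∑ f ≡ ∑ g
∑-cong {f = f} {g} f≗g = trans (∑≡sum f) (trans (sum-cong-≗ f≗g) (sym (∑≡sum g)))

∑-comm : ∀ {m n} (f : Fin m → Fin n → ℕ) →
         ∑ (λ i → ∑ (λ j → f i j)) ≡ ∑ (λ j → ∑ (λ i → f i j))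
∑-comm f = begin
  ∑ (λ i → ∑ (f i))              ≡⟨ ∑-cong (∑≡sum ∘ f) ⟩
  ∑ (λ i → sum (f i))            ≡⟨ ∑≡sum (λ i → sum (f i)) ⟩
  sum (λ i → sum (f i))          ≡⟨ sum-comm f ⟩
  sum (λ j → sum (λ i → f i j))  ≡⟨ sym (∑≡sum (λ j → sum (λ i → f i j))) ⟩
  ∑ (λ j → sum (λ i → f i j))    ≡⟨ ∑-cong (λ j → sym (∑≡sum (λ i → f i j))) ⟩
  ∑ (λ j → ∑ (λ i → f i j))      ∎
  where open ≡-Reasoning

st-not : ∀ u v → st (not u) (not v) ≡ st v u
st-not false false = refl
st-not false true  = refl
st-not true  false = refl
st-not true  true  = refl

crossing-reverse : ∀ {n} (w : Fin n → Fin n → ℕ) → (∀ i j → w i j ≡ w j i) →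
                   (a b : Fin n → Bool) →
                   ∑ (λ i → ∑ (λ j → w i j * st (not (b i)) (not (a j))))
                     ≡ ∑ (λ i → ∑ (λ j → w i j * st (a i) (b j)))
crossing-reverse w w-sym a b = begin
  ∑ (λ i → ∑ (λ j → w i j * st (not (b i)) (not (a j))))
    ≡⟨ ∑-cong (λ i → ∑-cong (λ j → cong₂ _*_ (w-sym i j) (st-not (b i) (a j)))) ⟩
  ∑ (λ i → ∑ (λ j → w j i * st (a j) (b i)))
    ≡⟨ ∑-comm (λ i j → w j i * st (a j) (b i)) ⟩
  ∑ (λ j → ∑ (λ i → w j i * st (a j) (b i)))
    ∎
  where open ≡-Reasoning

≟-sym : ∀ {n} (i j : Fin n) → ⌊ i ≟ j ⌋ ≡ ⌊ j ≟ i ⌋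
≟-sym i j = trans (isYes≗does (i ≟ j))
  (trans (does-⇔ (mk⇔ sym sym) (i ≟ j) (j ≟ i)) (sym (isYes≗does (j ≟ i))))

-- The edge predicates of cap, which Defs keeps local to its where-block.
module _ {n : ℕ} (γ : ℕ) where

  edgeXY : Fin n → Fin n → Bool
  edgeXY i j = if isD γ i then (if isD γ j then not ⌊ i ≟ j ⌋ else true) else isD γ j

  edgeX'Y' : Fin n → Fin n → Bool
  edgeX'Y' i j = not (isD γ i) ∧ not (isD γ j) ∧ not ⌊ i ≟ j ⌋

  edgeXY-sym : ∀ i j → edgeXY i j ≡ edgeXY j i
  edgeXY-sym i j with isD γ i | isD γ j
  ... | true  | true  = cong not (≟-sym i j)
  ... | true  | false = refl
  ... | false | true  = refl
  ... | false | false = refl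

  edgeX'Y'-sym : ∀ i j → edgeX'Y' i j ≡ edgeX'Y' j i
  edgeX'Y'-sym i j with isD γ i | isD γ j
  ... | true  | true  = refl
  ... | true  | false = refl
  ... | false | true  = refl
  ... | false | false = cong not (≟-sym i j)

reverse : ∀ {n} → Cut n → Cut n
reverse C = record
  { inX  = not ∘ inY C
  ; inY  = not ∘ inX C
  ; inX' = not ∘ inY' C
  ; inY' = not ∘ inX' C
  }

terminal-edges-reverse : ∀ {n} (c : Fin n → ℕ) (a b : Fin n → Bool) →
    ∑ (λ i → st true (not (b i)) * c i) + ∑ (λ i → st (not (a i)) false * c i)
      ≡ ∑ (λ i → st true (a i) * c i) + ∑ (λ i → st (b i) false * c i)
terminal-edges-reverse c a b = trans
  (cong₂ _+_ (∑-cong (λ i → cong (_* c i) (st-not false (b i))))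
             (∑-cong (λ i → cong (_* c i) (st-not (a i) true))))
  (+-comm (∑ (λ i → st (b i) false * c i)) (∑ (λ i → st true (a i) * c i)))

gadget-edges-reverse : ∀ {n} (w c : Fin n → ℕ) (a a' b b' : Fin n → Bool) →
    ∑ (λ i → w i * (st (not (b i)) (not (b' i)) * c i + st (not (a' i)) (not (a i)) * c i))
      ≡ ∑ (λ i → w i * (st (a i) (a' i) * c i + st (b' i) (b i) * c i))
gadget-edges-reverse w c a a' b b' = ∑-cong (λ i → cong (w i *_) (trans
  (cong₂ _+_ (cong (_* c i) (st-not (b i) (b' i))) (cong (_* c i) (st-not (a' i) (a i))))
  (+-comm (st (b' i) (b i) * c i) (st (a i) (a' i) * c i))))

cap-reverse : ∀ {n} (d : Fin n → ℕ) γ (C : Cut n) → cap d γ (reverse C) ≡ cap d γ C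
cap-reverse d γ C = cong₂ _+_ (cong₂ _+_ (cong₂ _+_
  (terminal-edges-reverse d (inX C) (inY C))
  (crossing-reverse (λ i j → [ edgeXY γ i j ]) (λ i j → cong [_] (edgeXY-sym γ i j))
                    (inX C) (inY C)))
  (gadget-edges-reverse (λ i → [ not (isD γ i) ]) (λ i → d i ∸ 1)
                        (inX C) (inX' C) (inY C) (inY' C)))
  (crossing-reverse (λ i j → [ edgeX'Y' γ i j ]) (λ i j → cong [_] (edgeX'Y'-sym γ i j))
                    (inX' C) (inY' C))

reverse-𝒮₀₁ : ∀ {n} γ (C : Cut n) → In𝒮₀₁ γ C → In𝒮₁₀ γ (reverse C)
reverse-𝒮₀₁ γ C (X-free , j , j∈D , yⱼ∈T) = (j , j∈D , cong not yⱼ∈T) , λ i i∈D → cong not (X-free i i∈D)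

reverse-𝒮₁₀ : ∀ {n} γ (C : Cut n) → In𝒮₁₀ γ C → In𝒮₀₁ γ (reverse C)
reverse-𝒮₁₀ γ C ((i , i∈D , xᵢ∈S) , Y-full) = (λ j j∈D → cong not (Y-full j j∈D)) , i , i∈D , cong not xᵢ∈S

record _≗ᶜ_ {n} (C D : Cut n) : Set where
  field
    inX≗  : inX C ≗ inX D
    inY≗  : inY C ≗ inY D
    inX'≗ : inX' C ≗ inX' D
    inY'≗ : inY' C ≗ inY' D
open _≗ᶜ_

cap-cong : ∀ {n} (d : Fin n → ℕ) γ {C D : Cut n} → C ≗ᶜ D → cap d γ C ≡ cap d γ D
cap-cong d γ C≗D =
  cong₂ _+_ (cong₂ _+_ (cong₂ _+_ (cong₂ _+_
    (∑-cong (λ i → cong (λ u → st true u * d i) (inX≗ C≗D i)))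
    (∑-cong (λ i → cong (λ u → st u false * d i) (inY≗ C≗D i))))
    (∑-cong (λ i → ∑-cong (λ j →
      cong₂ (λ u v → [ edgeXY γ i j ] * st u v) (inX≗ C≗D i) (inY≗ C≗D j)))))
    (∑-cong (λ i → cong₂ (λ u v → [ not (isD γ i) ] * (u + v))
      (cong₂ (λ u v → st u v * (d i ∸ 1)) (inX≗ C≗D i) (inX'≗ C≗D i))
      (cong₂ (λ u v → st u v * (d i ∸ 1)) (inY'≗ C≗D i) (inY≗ C≗D i)))))
    (∑-cong (λ i → ∑-cong (λ j →
      cong₂ (λ u v → [ edgeX'Y' γ i j ] * st u v) (inX'≗ C≗D i) (inY'≗ C≗D j))))

In𝒮₀₁-cong : ∀ {n} γ {C D : Cut n} → C ≗ᶜ D → In𝒮₀₁ γ C → In𝒮₀₁ γ D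
In𝒮₀₁-cong γ C≗D (X-free , j , j∈D , yⱼ∈T) =
  (λ i i∈D → trans (sym (inX≗ C≗D i)) (X-free i i∈D)) , j , j∈D , trans (sym (inY≗ C≗D j)) yⱼ∈T

In𝒮₀₁? : ∀ {n} γ → Decidable (In𝒮₀₁ {n} γ)
In𝒮₀₁? γ C = all? (λ i → (isD γ i Bool.≟ true) →-dec (inX C i Bool.≟ false))
      ×-dec any? (λ j → (isD γ j Bool.≟ true) ×-dec (inY C j Bool.≟ false))

allInT : ∀ {n} → Cut n
allInT = record { inX = λ _ → false ; inY = λ _ → false ; inX' = λ _ → false ; inY' = λ _ → false }

allInT∈𝒮₀₁ : ∀ {n γ} → 1 ≤ γ → γ ≤ n → In𝒮₀₁ {n} γ allInT
allInT∈𝒮₀₁ {suc n} {suc γ} _ _ = (λ _ _ → refl) , F.zero , refl , refl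

booleanVectors : ∀ n → List (Vec Bool n)
booleanVectors zero    = [] ∷ₗ []ₗ
booleanVectors (suc n) = cartesianProductWith _∷_ (true ∷ₗ false ∷ₗ []ₗ) (booleanVectors n)

∈-booleanVectors : ∀ {n} (v : Vec Bool n) → v ∈ booleanVectors n
∈-booleanVectors []      = here refl
∈-booleanVectors (b ∷ v) = ∈-cartesianProductWith⁺ _∷_ (∈-bools b) (∈-booleanVectors v)
  where
  ∈-bools : ∀ b → b ∈ true ∷ₗ false ∷ₗ []ₗ
  ∈-bools true  = here refl
  ∈-bools false = there (here refl)

cutOf : ∀ {n} → Vec Bool n × Vec Bool n → Vec Bool n × Vec Bool n → Cut n
cutOf (x , y) (x' , y') =
  record { inX = lookup x ; inY = lookup y ; inX' = lookup x' ; inY' = lookup y' }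

cuts : ∀ n → List (Cut n)
cuts n = cartesianProductWith cutOf pairs pairs
  where
  pairs : List (Vec Bool n × Vec Bool n)
  pairs = cartesianProduct (booleanVectors n) (booleanVectors n)

cuts-complete : ∀ {n} (C : Cut n) → ∃[ D ] D ∈ cuts n × C ≗ᶜ D
cuts-complete C =
  _ , ∈-cartesianProductWith⁺ cutOf (∈-pairs (inX C) (inY C)) (∈-pairs (inX' C) (inY' C)) , record
  { inX≗  = sym ∘ lookup∘tabulate (inX C)
  ; inY≗  = sym ∘ lookup∘tabulate (inY C)
  ; inX'≗ = sym ∘ lookup∘tabulate (inX' C)
  ; inY'≗ = sym ∘ lookup∘tabulate (inY' C)
  }
  where
  ∈-pairs : ∀ {n} (f g : Fin n → Bool) →
            (tabulate f , tabulate g) ∈ cartesianProduct (booleanVectors n) (booleanVectors n)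
  ∈-pairs f g = ∈-cartesianProduct⁺ (∈-booleanVectors (tabulate f)) (∈-booleanVectors (tabulate g))

-- The list need not contain every element of P, only one at least as good as each.
minimiser : ∀ {A : Set} (f : A → ℕ) {P : A → Set} → Decidable P → (xs : List A) →
            (∀ {a} → P a → ∃[ b ] b ∈ xs × P b × f b ≤ f a) →
            ∃ P → ∃[ m ] P m × (∀ a → P a → f m ≤ f a)
minimiser {A} f {P} P? xs dominated (a₀ , Pa₀) =
  m , argmin-all f Pa₀ (all-filter P? xs) , m≤
  where
  m : A
  m = argmin f a₀ (filter P? xs)
  m≤ : ∀ a → P a → f m ≤ f a
  m≤ a Pa with b , b∈xs , Pb , fb≤fa ← dominated Pa =
    ≤-trans (All.lookup (f[argmin]≤f[xs] a₀ (filter P? xs)) (∈-filter⁺ P? b∈xs Pb)) fb≤fa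

cuts-dominate : ∀ {n} (d : Fin n → ℕ) γ {P : Cut n → Set} → (∀ {C D} → C ≗ᶜ D → P C → P D) →
                ∀ {C} → P C → ∃[ D ] D ∈ cuts n × P D × cap d γ D ≤ cap d γ C
cuts-dominate d γ P-cong {C} PC with D , D∈cuts , C≗D ← cuts-complete C =
  D , D∈cuts , P-cong C≗D PC , ≤-reflexive (sym (cap-cong d γ C≗D))

IsMinCap-exists : ∀ {n} (d : Fin n → ℕ) γ {P : Cut n → Set} → Decidable P →
                  (∀ {C D} → C ≗ᶜ D → P C → P D) → ∃ P → ∃ (IsMinCap d γ P)
IsMinCap-exists {n} d γ P? P-cong inhabited =
  let C , PC , C-min = minimiser (cap d γ) P? (cuts n) (cuts-dominate d γ P-cong) inhabited
  in  cap d γ C , (C , PC , refl) , C-min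

IsMinCap-reverse : ∀ {n} (d : Fin n → ℕ) γ {P Q : Cut n → Set} →
                   (∀ C → P C → Q (reverse C)) → (∀ C → Q C → P (reverse C)) →
                   ∀ {m} → IsMinCap d γ P m → IsMinCap d γ Q m
IsMinCap-reverse d γ P⇒Q Q⇒P ((C , PC , refl) , C-min) =
  (reverse C , P⇒Q C PC , cap-reverse d γ C) ,
  λ D QD → ≤-trans (C-min (reverse D) (Q⇒P D QD)) (≤-reflexive (cap-reverse d γ D))

lemma5 : (n : ℕ) (d : Fin n → ℕ) (γ : ℕ)
       → (∀ i → 1 ≤ d i)
       → 1 ≤ γ → γ ≤ n
       → Σ ℕ (λ m → IsMinCap d γ (In𝒮₀₁ γ) m × IsMinCap d γ (In𝒮₁₀ γ) m)
lemma5 n d γ _ 1≤γ γ≤n =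
  let m , m-min = IsMinCap-exists d γ (In𝒮₀₁? γ) (In𝒮₀₁-cong γ) (allInT , allInT∈𝒮₀₁ 1≤γ γ≤n)
  in  m , m-min , IsMinCap-reverse d γ (reverse-𝒮₀₁ γ) (reverse-𝒮₁₀ γ) m-min
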